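{- For $n\ge 0$ let $C_{2n}(132)$ be the set of centrosymmetric permutations of $[2n]=\{1,\dots,2n\}$ avoiding the pattern $132$, let $q_{n,k}$ be the number of elements of $C_{2n}(132)$ with exactly $k$ descents, and let $$Q(x,y)=\sum_{n\ge 0}\sum_{\sigma\in C_{2n}(132)}x^n y^{\mathrm{des}(\sigma)}=\sum_{n,k\ge0}q_{n,k}x^ny^k .$$ Then $$Q(x,y)=1+\frac{x(1+y)}{1-x(1+y^2)}.$$ Hence, for every $n\ge 1$ and $k\ge 0$, $q_{n,k}=\binom{n-1}{\lfloor k/2\rfloor}$.
   Context: A permutation $\sigma$ of $[m]$ is centrosymmetric if $\sigma(i)+\sigma(m+1-i)=m+1$ for all $i$. A permutation $\sigma$ of $[m]$ avoids the pattern $132$ if there are no indices $i<j<k$ with $\sigma(i)<\sigma(k)<\sigma(j)$. A descent of $\sigma$ is an index $i$ with $\sigma(i)>\sigma(i+1)$, and $\mathrm{des}(\sigma)$ is the number of descents. $C_0(132)$ consists of the empty permutation, with $0$ descents. -}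

module Defs where

open import Data.Nat using (ℕ; zero; suc; _+_; _*_; _<ᵇ_)
open import Data.Fin using (Fin; toℕ; opposite; _<_)
open import Data.Fin.Properties using (_≟_; _<?_; any?; all?)
open import Data.Vec using (Vec; []; _∷_; lookup; toList)
open import Data.List using (List; []; _∷_; allFin; concatMap; map; filter; length)
open import Data.Product using (∃; _×_; _,_)
open import Data.Bool using (if_then_else_)
open import Relation.Nullary using (Dec; ¬_; ¬?)
open import Relation.Nullary.Decidable using (_×-dec_; _→-dec_)
open import Relation.Binary.PropositionalEquality using (_≡_)
import Data.Nat.Properties as ℕP

-- A permutation of [m] in one-line notation: a word σ(1) … σ(m) over
-- Fin m (value j : Fin m stands for j+1 ∈ [m]) that is injective.
Word : ℕ → Set
Word m = Vec (Fin m) m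

IsPerm : {m : ℕ} → Word m → Set
IsPerm {m} σ = ∀ (i j : Fin m) → lookup σ i ≡ lookup σ j → i ≡ j

-- σ(i) + σ(m+1-i) = m+1 (1-indexed values; 'opposite i' is position m+1-i)
Centrosymmetric : {m : ℕ} → Word m → Set
Centrosymmetric {m} σ =
  ∀ (i : Fin m) → suc (toℕ (lookup σ i)) + suc (toℕ (lookup σ (opposite i))) ≡ suc m

Occ132 : {m : ℕ} → Word m → Set
Occ132 {m} σ = ∃ λ (i : Fin m) → ∃ λ (j : Fin m) → ∃ λ (k : Fin m) →
  (i < j) × (j < k) × (lookup σ i < lookup σ k) × (lookup σ k < lookup σ j)

Avoids132 : {m : ℕ} → Word m → Set
Avoids132 σ = ¬ Occ132 σ

desL : {m : ℕ} → List (Fin m) → ℕ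
desL [] = 0
desL (x ∷ []) = 0
desL (x ∷ y ∷ r) = (if toℕ y <ᵇ toℕ x then 1 else 0) + desL (y ∷ r)

des : {m : ℕ} → Word m → ℕ
des σ = desL (toList σ)

isPerm? : {m : ℕ} (σ : Word m) → Dec (IsPerm σ)
isPerm? σ = all? λ i → all? λ j → (lookup σ i ≟ lookup σ j) →-dec (i ≟ j)

centro? : {m : ℕ} (σ : Word m) → Dec (Centrosymmetric σ)
centro? {m} σ = all? λ i →
  suc (toℕ (lookup σ i)) + suc (toℕ (lookup σ (opposite i))) ℕP.≟ suc m

avoids132? : {m : ℕ} (σ : Word m) → Dec (Avoids132 σ)
avoids132? σ = ¬? (any? λ i → any? λ j → any? λ k →
  (i <? j) ×-dec (j <? k) ×-dec (lookup σ i <? lookup σ k) ×-dec (lookup σ k <? lookup σ j))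

words : (m n : ℕ) → List (Vec (Fin m) n)
words m zero = [] ∷ []
words m (suc n) = concatMap (λ x → map (x ∷_) (words m n)) (allFin m)

C132 : (m : ℕ) → List (Word m)
C132 m = filter (λ σ → isPerm? σ ×-dec centro? σ ×-dec avoids132? σ) (words m m)

q : ℕ → ℕ → ℕ
q n k = length (filter (λ σ → des σ ℕP.≟ k) (C132 (2 * n)))

module Submission where

-- Permutations are handled as maps F : ℕ → ℕ, injective and bounded on [0,m).
--  * A permutation whose ascents all go up by exactly one ("unit ascents") is determined
--    by its descents: two such permutations with the same descents order [0,m) alike, and
--    by pigeonhole a permutation is determined by the order it induces.
--  * Every descent pattern b is realised by a unit-ascent permutation (FromDescents), and
--    unit-ascent permutations avoid 132.
--  * Reverse-complement turns a 213 into a 132, so a centrosymmetric 132-avoider also avoids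
--    213, which forces unit ascents; its descent pattern is a palindrome, and conversely the
--    permutation built from a palindromic pattern is centrosymmetric.
-- Hence C_{2n+2}(132) is in bijection with the palindromes u c ū of length 2n+1, i.e. with
-- codes (u , c) ∈ Bool^n × Bool, the number of descents being 2·|u| + c.  Counting codes
-- by this weight gives binom(n, ⌊k/2⌋).  The file ends by transporting the bijection to
-- the list-based definitions of Defs (words, C132, q).

open import Defs
open import Data.Nat
open import Data.Nat.Properties
open import Data.Bool using (Bool; true; false; T; if_then_else_)
open import Data.Nat.DivMod using (_/_; m/n≡1+[m∸n]/n)
open import Data.Nat.Combinatorics using (_C_; nCk+nC[k+1]≡[n+1]C[k+1])
open import Data.Fin as Fin using (Fin; toℕ; fromℕ<; punchOut)
open import Data.Fin.Properties using (toℕ<n; toℕ-fromℕ<; toℕ-injective; punchOut-injective; any?; injective⇒≤; opposite-prop)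
open import Data.Vec using (Vec; []; _∷_; lookup; tabulate; toList)
open import Data.List using (List; []; _∷_; _++_; concatMap; reverse; length; map; filter; cartesianProduct; cartesianProductWith; allFin)
open import Data.List.Properties using (unfold-reverse; reverse-++; reverse-involutive; length-reverse; length-++; ++-assoc; length-map)
open import Data.List.Membership.Propositional using (_∈_)
open import Data.List.Membership.Propositional.Properties
  using (∈-filter⁺; ∈-filter⁻; ∈-map⁺; ∈-map⁻; ∈-cartesianProductWith⁺; ∈-cartesianProduct⁺; ∈-allFin)
open import Data.List.Membership.Propositional.Properties.WithK using (unique∧set⇒bag)
open import Data.List.Relation.Binary.BagAndSetEquality using (∼bag⇒↭)
open import Data.List.Relation.Binary.Permutation.Propositional.Properties using (↭-length)
open import Data.List.Relation.Unary.Any using (here; there)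
open import Data.List.Relation.Unary.All using ([]; _∷_)
open import Data.List.Relation.Unary.AllPairs using ([]; _∷_)
open import Data.List.Relation.Unary.Unique.Propositional using (Unique)
import Data.List.Relation.Unary.Unique.Propositional.Properties as Unique
open import Data.Vec.Properties using (lookup∘tabulate; tabulate∘lookup; tabulate-cong; ∷-injective)
open import Data.Product using (∃; _×_; _,_; proj₁; proj₂)
open import Data.Sum using (_⊎_; inj₁; inj₂)
open import Data.Empty using (⊥; ⊥-elim)
open import Relation.Nullary using (¬_; Dec; yes; no; does; contradiction)
open import Relation.Nullary.Decidable using (_×-dec_)
open import Relation.Unary using (Decidable)
open import Relation.Binary using (Tri; tri<; tri≈; tri>)
open import Relation.Binary.PropositionalEquality
open import Function.Bundles using (Equivalence; mk⇔)
open import Data.Bool.Properties using (T-≡; ¬-not)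

BoundedOn : (ℕ → ℕ) → ℕ → Set
BoundedOn F m = ∀ {i} → i < m → F i < m

InjectiveOn : (ℕ → ℕ) → ℕ → Set
InjectiveOn F m = ∀ {i j} → i < m → j < m → F i ≡ F j → i ≡ j

pigeonhole : ∀ {k n} (f : Fin k → ℕ) → (∀ x → f x < n) →
             (∀ {x y} → f x ≡ f y → x ≡ y) → k ≤ n
pigeonhole f f<n f-inj = injective⇒≤ {f = λ x → fromℕ< (f<n x)} λ {x} {y} e →
  f-inj (trans (sym (toℕ-fromℕ< (f<n x))) (trans (cong toℕ e) (toℕ-fromℕ< (f<n y))))

onto : ∀ {F m} → BoundedOn F m → InjectiveOn F m →
       ∀ {v} → v < m → ∃ λ i → i < m × F i ≡ v
onto {F} {suc m} F<m F-inj {v} v<m with any? (λ (x : Fin (suc m)) → F (toℕ x) ≟ v)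
... | yes (x , Fx≡v) = toℕ x , toℕ<n x , Fx≡v
... | no missed = contradiction (injective⇒≤ squeeze-inj) 1+n≰n
  where
  value : Fin (suc m) → Fin (suc m)
  value x = fromℕ< (F<m (toℕ<n x))
  toℕ-value : ∀ x → toℕ (value x) ≡ F (toℕ x)
  toℕ-value x = toℕ-fromℕ< (F<m (toℕ<n x))
  v≢value : ∀ x → fromℕ< v<m ≢ value x
  v≢value x e = missed (x , trans (sym (toℕ-value x)) (trans (cong toℕ (sym e)) (toℕ-fromℕ< v<m)))
  -- delete the missed value v from the range: an injection of m+1 points into m
  squeeze : Fin (suc m) → Fin m
  squeeze x = punchOut (v≢value x)
  squeeze-inj : ∀ {x y} → squeeze x ≡ squeeze y → x ≡ y
  squeeze-inj {x} {y} e = toℕ-injective (F-inj (toℕ<n x) (toℕ<n y)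
    (trans (sym (toℕ-value x)) (trans (cong toℕ (punchOut-injective (v≢value x) (v≢value y) e)) (toℕ-value y))))

Refines : (ℕ → ℕ) → (ℕ → ℕ) → ℕ → Set
Refines F G m = ∀ {i j} → i < m → j < m → F i < F j → G i < G j

-- F i counts the values below it; G sends the points carrying them below G i.
rank-≤ : ∀ {F G m} → BoundedOn F m → InjectiveOn F m → InjectiveOn G m →
         Refines F G m → ∀ {i} → i < m → F i ≤ G i
rank-≤ {F} {G} {m} F<m F-inj G-inj F⊑G {i} i<m = pigeonhole (λ k → G (point k)) below distinct
  where
  preimage : (k : Fin (F i)) → ∃ λ p → p < m × F p ≡ toℕ k
  preimage k = onto F<m F-inj (<-trans (toℕ<n k) (F<m i<m))
  point : Fin (F i) → ℕ
  point k = proj₁ (preimage k)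
  below : ∀ k → G (point k) < G i
  below k with preimage k
  ... | p , p<m , Fp≡k = F⊑G p<m i<m (subst (_< F i) (sym Fp≡k) (toℕ<n k))
  distinct : ∀ {k l} → G (point k) ≡ G (point l) → k ≡ l
  distinct {k} {l} e with preimage k | preimage l
  ... | p , p<m , Fp≡k | r , r<m , Fr≡l =
    toℕ-injective (trans (sym Fp≡k) (trans (cong F (G-inj p<m r<m e)) Fr≡l))

same-order⇒equal : ∀ {F G m} → BoundedOn F m → BoundedOn G m →
                   InjectiveOn F m → InjectiveOn G m →
                   Refines F G m → Refines G F m → ∀ {i} → i < m → F i ≡ G i
same-order⇒equal F<m G<m F-inj G-inj F⊑G G⊑F i<m =
  ≤-antisym (rank-≤ F<m F-inj G-inj F⊑G i<m) (rank-≤ G<m G-inj F-inj G⊑F i<m)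

<ᵇ-true : ∀ {x y} → x < y → (x <ᵇ y) ≡ true
<ᵇ-true x<y = Equivalence.to T-≡ (<⇒<ᵇ x<y)

<ᵇ-false : ∀ {x y} → ¬ x < y → (x <ᵇ y) ≡ false
<ᵇ-false {x} {y} x≮y = ¬-not λ e → x≮y (<ᵇ⇒< x y (Equivalence.from T-≡ e))

<ᵇ-false⁻¹ : ∀ {x y} → (x <ᵇ y) ≡ false → ¬ x < y
<ᵇ-false⁻¹ e x<y = subst T e (<⇒<ᵇ x<y)

descent : (ℕ → ℕ) → ℕ → Bool
descent F l = F (suc l) <ᵇ F l

SameDescents : (ℕ → ℕ) → (ℕ → ℕ) → ℕ → Set
SameDescents F G m = ∀ l → suc l < m → descent F l ≡ descent G l

NoDescentIn : (ℕ → ℕ) → ℕ → ℕ → Set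
NoDescentIn F i d = ∀ e → e < d → descent F (i + e) ≡ false

Avoids132On : (ℕ → ℕ) → ℕ → Set
Avoids132On F m = ∀ {i j k} → i < j → j < k → k < m → F i < F k → F k < F j → ⊥

UnitAscents : (ℕ → ℕ) → ℕ → Set
UnitAscents F m = ∀ {i} → suc i < m → F i < F (suc i) → F (suc i) ≡ suc (F i)

Climbs : (ℕ → ℕ) → ℕ → ℕ → Set
Climbs F i d = ∀ e → e ≤ d → F (i + e) ≡ F i + e

offset-zero : ∀ F i → F (i + 0) ≡ F i + 0
offset-zero F i = trans (cong F (+-identityʳ i)) (sym (+-identityʳ (F i)))

climbs-cons : ∀ {F i d} → F (suc i) ≡ suc (F i) → Climbs F (suc i) d → Climbs F i (suc d)
climbs-cons {F} {i} step climbs zero _ = offset-zero F i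
climbs-cons {F} {i} step climbs (suc e) e≤d = begin
  F (i + suc e)   ≡⟨ cong F (+-suc i e) ⟩
  F (suc i + e)   ≡⟨ climbs e (s≤s⁻¹ e≤d) ⟩
  F (suc i) + e   ≡⟨ cong (_+ e) step ⟩
  suc (F i + e)   ≡⟨ sym (+-suc (F i) e) ⟩
  F i + suc e     ∎
  where open ≡-Reasoning

offset-≤ : ∀ {v a d} → v ≤ a + d → v ∸ a ≤ d
offset-≤ {v} {a} {d} v≤a+d = subst (v ∸ a ≤_) (m+n∸m≡n a d) (∸-monoˡ-≤ a v≤a+d)

climb-hits : ∀ {F j d v} → Climbs F j d → F j ≤ v → v ≤ F j + d → F (j + (v ∸ F j)) ≡ v
climb-hits {F} {j} {d} {v} climbs Fj≤v v≤top = trans (climbs (v ∸ F j) (offset-≤ v≤top)) (m+[n∸m]≡n Fj≤v)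

climbs⇒no-descent : ∀ {F i d} → Climbs F i d → NoDescentIn F i d
climbs⇒no-descent {F} {i} climbs e e<d =
  <ᵇ-false (subst₂ (λ a b → ¬ a < b) (sym (trans (cong F (sym (+-suc i e))) (climbs (suc e) e<d)))
                                      (sym (climbs e (<⇒≤ e<d)))
                                      (λ lt → <-asym lt (+-monoʳ-< (F i) (n<1+n e))))

within : ∀ {i d e m} → i + d < m → e ≤ d → i + e < m
within {i} i+d<m e≤d = ≤-<-trans (+-monoʳ-≤ i e≤d) i+d<m

module UnitAscentMap {F : ℕ → ℕ} {m : ℕ} (F-inj : InjectiveOn F m) (F-unit : UnitAscents F m) where

  flat-step : ∀ {i} → suc i < m → descent F i ≡ false → F (suc i) ≡ suc (F i)
  flat-step {i} si<m no-descent = F-unit si<m (≤∧≢⇒< (≮⇒≥ (<ᵇ-false⁻¹ no-descent))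
    λ e → 1+n≢n (sym (F-inj (<-trans (n<1+n i) si<m) si<m e)))

  climb-flat : ∀ d i → i + d < m → NoDescentIn F i d → F (i + d) ≡ F i + d
  climb-flat zero i _ _ = offset-zero F i
  climb-flat (suc d) i i+sd<m flat = begin
    F (i + suc d)     ≡⟨ cong F (+-suc i d) ⟩
    F (suc (i + d))   ≡⟨ flat-step (subst (_< m) (+-suc i d) i+sd<m) (flat d (n<1+n d)) ⟩
    suc (F (i + d))   ≡⟨ cong suc (climb-flat d i (within i+sd<m (n≤1+n d)) (λ e e<d → flat e (m<n⇒m<1+n e<d))) ⟩
    suc (F i + d)     ≡⟨ sym (+-suc (F i) d) ⟩
    F i + suc d       ∎
    where open ≡-Reasoning

  climb : ∀ d i → i + d < m → F i ≤ F (i + d) → Climbs F i d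
  climb zero i _ _ zero z≤n = offset-zero F i
  climb (suc d) i i+sd<m Fi≤end = by-first-step (<-cmp (F i) (F (suc i)))
    where
    si+d<m : suc i + d < m
    si+d<m = subst (_< m) (+-suc i d) i+sd<m
    si<m : suc i < m
    si<m = ≤-<-trans (m≤m+n (suc i) d) si+d<m
    i<m : i < m
    i<m = <-trans (n<1+n i) si<m
    Fi≤end′ : F i ≤ F (suc i + d)
    Fi≤end′ = subst (F i ≤_) (cong F (+-suc i d)) Fi≤end
    by-first-step : Tri (F i < F (suc i)) (F i ≡ F (suc i)) (F (suc i) < F i) → Climbs F i (suc d)
    by-first-step (tri< up _ _) = climbs-cons {F} step (climb d (suc i) si+d<m Fsi≤end)
      where
      step : F (suc i) ≡ suc (F i)
      step = F-unit si<m up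
      Fsi≤end : F (suc i) ≤ F (suc i + d)
      Fsi≤end = subst (_≤ F (suc i + d)) (sym step)
        (≤∧≢⇒< Fi≤end′ λ e → <⇒≢ (s≤s (m≤m+n i d)) (F-inj i<m si+d<m e))
    by-first-step (tri≈ _ same _) = ⊥-elim (<⇒≢ (n<1+n i) (F-inj i<m si<m same))
    -- after a first descent F would have to come back through the value F i
    by-first-step (tri> _ _ down) = ⊥-elim (<⇒≢ (s≤s (m≤m+n i _)) (sym returns))
      where
      rest : Climbs F (suc i) d
      rest = climb d (suc i) si+d<m (≤-trans (<⇒≤ down) Fi≤end′)
      Fi≤top : F i ≤ F (suc i) + d
      Fi≤top = subst (F i ≤_) (rest d ≤-refl) Fi≤end′
      returns : suc i + (F i ∸ F (suc i)) ≡ i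
      returns = F-inj (within {suc i} si+d<m (offset-≤ {a = F (suc i)} Fi≤top)) i<m (climb-hits {F} rest (<⇒≤ down) Fi≤top)

  -- in particular F contains no 132: the middle entry would lie on the climb from the first to the last
  avoids-132 : Avoids132On F m
  avoids-132 {i} i<j j<k k<m Fi<Fk Fk<Fj
    with e , refl ← m≤n⇒∃[o]m+o≡n (<⇒≤ i<j) | d , refl ← m≤n⇒∃[o]m+o≡n (<⇒≤ (<-trans i<j j<k)) =
    <-asym Fk<Fj (subst₂ _<_ (sym (climbs e (<⇒≤ e<d))) (sym (climbs d ≤-refl)) (+-monoʳ-< (F i) e<d))
    where
    climbs : Climbs F i d
    climbs = climb d i k<m (<⇒≤ Fi<Fk)
    e<d : e < d
    e<d = +-cancelˡ-< i e d j<k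

-- If F rises from i to j, it climbs there; G, having the same descents, climbs there as well.
rise-transfer : ∀ {F G m} → InjectiveOn F m → UnitAscents F m → InjectiveOn G m → UnitAscents G m →
                SameDescents F G m → ∀ {i j} → i ≤ j → j < m → F i ≤ F j → G i ≤ G j
rise-transfer {F} {G} {m} F-inj F-unit G-inj G-unit same {i} i≤j j<m Fi≤Fj
  with d , refl ← m≤n⇒∃[o]m+o≡n i≤j =
  subst (G i ≤_) (sym (UnitAscentMap.climb-flat G-inj G-unit d i j<m G-flat)) (m≤m+n (G i) d)
  where
  G-flat : NoDescentIn G i d
  G-flat e e<d = trans (sym (same (i + e) (subst (_< m) (+-suc i e) (within {i} j<m e<d))))
    (climbs⇒no-descent {F} (UnitAscentMap.climb F-inj F-unit d i j<m Fi≤Fj) e e<d)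

order-transfer : ∀ {F G m} → InjectiveOn F m → UnitAscents F m → InjectiveOn G m → UnitAscents G m →
                 SameDescents F G m → Refines F G m
order-transfer {F} {G} F-inj F-unit G-inj G-unit same {i} {j} i<m j<m Fi<Fj with ≤-total i j
... | inj₁ i≤j = ≤∧≢⇒< (rise-transfer F-inj F-unit G-inj G-unit same i≤j j<m (<⇒≤ Fi<Fj))
                       λ e → <⇒≢ Fi<Fj (cong F (G-inj i<m j<m e))
... | inj₂ j≤i with G i <? G j
...   | yes Gi<Gj = Gi<Gj
...   | no Gi≮Gj = contradiction
        (rise-transfer G-inj G-unit F-inj F-unit (λ l p → sym (same l p)) j≤i i<m (≮⇒≥ Gi≮Gj)) (<⇒≱ Fi<Fj)

determined-by-descents : ∀ {F G m} → BoundedOn F m → BoundedOn G m →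
                         InjectiveOn F m → UnitAscents F m → InjectiveOn G m → UnitAscents G m →
                         SameDescents F G m → ∀ {i} → i < m → F i ≡ G i
determined-by-descents F<m G<m F-inj F-unit G-inj G-unit same =
  same-order⇒equal F<m G<m F-inj G-inj (order-transfer F-inj F-unit G-inj G-unit same)
                   (order-transfer G-inj G-unit F-inj F-unit (λ l p → sym (same l p)))

∸-step : ∀ {m n} → n < m → m ∸ n ≡ suc (m ∸ suc n)
∸-step {suc m} n<m = +-∸-assoc 1 (s≤s⁻¹ n<m)

-- The unit-ascent permutation of [0,m) whose descents are the l with b l.  Its runs (maximal
-- stretches without descents) count upwards, and every run lies below all earlier runs:
-- position i gets the number of positions after its run plus its offset within the run.
module FromDescents (b : ℕ → Bool) (m : ℕ) where

  runStart : ℕ → ℕ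
  runStart zero = zero
  runStart (suc i) = if b i then suc i else runStart i

  toRunEnd : ℕ → ℕ → ℕ
  toRunEnd zero i = 0
  toRunEnd (suc f) i = if b i then 0 else suc (toRunEnd f (suc i))

  -- last position of the run containing i (the last position of [0,m) ends every run)
  runEnd : ℕ → ℕ
  runEnd i = i + toRunEnd (m ∸ suc i) i

  perm : ℕ → ℕ
  perm i = (m ∸ suc (runEnd i)) + (i ∸ runStart i)

  runStart-≤ : ∀ i → runStart i ≤ i
  runStart-≤ zero = z≤n
  runStart-≤ (suc i) with b i
  ... | true = ≤-refl
  ... | false = m≤n⇒m≤1+n (runStart-≤ i)

  runStart-flat : ∀ {i} → b i ≡ false → runStart (suc i) ≡ runStart i
  runStart-flat bi rewrite bi = refl

  runStart-descent : ∀ {i} → b i ≡ true → runStart (suc i) ≡ suc i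
  runStart-descent bi rewrite bi = refl

  start-after-descent : ∀ {l j} → b l ≡ true → l < j → suc l ≤ runStart j
  start-after-descent {l} {suc j} bl l<sj with m≤n⇒m<n∨m≡n (s≤s⁻¹ l<sj)
  ... | inj₂ refl rewrite bl = ≤-refl
  ... | inj₁ l<j with b j
  ...   | true = l<sj
  ...   | false = start-after-descent bl l<j

  toRunEnd-≤ : ∀ f i → toRunEnd f i ≤ f
  toRunEnd-≤ zero i = z≤n
  toRunEnd-≤ (suc f) i with b i
  ... | true = z≤n
  ... | false = s≤s (toRunEnd-≤ f (suc i))

  end-before-descent : ∀ k f i → b (i + k) ≡ true → toRunEnd f i ≤ k
  end-before-descent k zero i _ = z≤n
  end-before-descent k (suc f) i b[i+k] with b i in bi
  ... | true = z≤n
  end-before-descent zero (suc f) i b[i+k] | false =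
    contradiction (trans (sym bi) (trans (cong b (sym (+-identityʳ i))) b[i+k])) λ ()
  end-before-descent (suc k) (suc f) i b[i+k] | false =
    s≤s (end-before-descent k f (suc i) (trans (cong b (sym (+-suc i k))) b[i+k]))

  runEnd-<m : ∀ {j} → j < m → runEnd j < m
  runEnd-<m {j} j<m = ≤-<-trans (+-monoʳ-≤ j (toRunEnd-≤ (m ∸ suc j) j))
                                (subst (j + (m ∸ suc j) <_) (m+[n∸m]≡n j<m) ≤-refl)

  runEnd-flat : ∀ {i} → suc i < m → b i ≡ false → runEnd i ≡ runEnd (suc i)
  runEnd-flat {i} si<m bi = begin
    i + toRunEnd (m ∸ suc i) i                          ≡⟨ cong (λ f → i + toRunEnd f i) (∸-step si<m) ⟩
    i + toRunEnd (suc (m ∸ suc (suc i))) i              ≡⟨ cong (λ c → i + (if c then 0 else suc (toRunEnd (m ∸ suc (suc i)) (suc i)))) bi ⟩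
    i + suc (toRunEnd (m ∸ suc (suc i)) (suc i))        ≡⟨ +-suc i _ ⟩
    suc i + toRunEnd (m ∸ suc (suc i)) (suc i)          ∎
    where open ≡-Reasoning

  runEnd-descent : ∀ {i} → b i ≡ true → runEnd i ≡ i
  runEnd-descent {i} bi = trans (cong (i +_) (toRunEnd-descent (m ∸ suc i))) (+-identityʳ i)
    where
    toRunEnd-descent : ∀ f → toRunEnd f i ≡ 0
    toRunEnd-descent zero = refl
    toRunEnd-descent (suc f) rewrite bi = refl

  perm-flat : ∀ {i} → suc i < m → b i ≡ false → perm (suc i) ≡ suc (perm i)
  perm-flat {i} si<m bi = begin
    (m ∸ suc (runEnd (suc i))) + (suc i ∸ runStart (suc i))
      ≡⟨ cong₂ (λ e s → (m ∸ suc e) + (suc i ∸ s)) (sym (runEnd-flat si<m bi)) (runStart-flat bi) ⟩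
    (m ∸ suc (runEnd i)) + (suc i ∸ runStart i)
      ≡⟨ cong ((m ∸ suc (runEnd i)) +_) (+-∸-assoc 1 (runStart-≤ i)) ⟩
    (m ∸ suc (runEnd i)) + suc (i ∸ runStart i)
      ≡⟨ +-suc _ _ ⟩
    suc (perm i) ∎
    where open ≡-Reasoning

  perm-descent : ∀ {i} → suc i < m → b i ≡ true → perm (suc i) < perm i
  perm-descent {i} si<m bi = begin-strict
    (m ∸ suc (runEnd (suc i))) + (suc i ∸ runStart (suc i))
      ≡⟨ cong (λ s → (m ∸ suc (runEnd (suc i))) + (suc i ∸ s)) (runStart-descent bi) ⟩
    (m ∸ suc (runEnd (suc i))) + (suc i ∸ suc i)
      ≡⟨ cong ((m ∸ suc (runEnd (suc i))) +_) (n∸n≡0 i) ⟩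
    (m ∸ suc (runEnd (suc i))) + 0
      ≡⟨ +-identityʳ _ ⟩
    m ∸ suc (runEnd (suc i))
      ≤⟨ ∸-monoʳ-≤ m (s≤s (m≤m+n (suc i) _)) ⟩
    m ∸ suc (suc i)
      <⟨ ∸-monoʳ-< (n<1+n (suc i)) si<m ⟩
    m ∸ suc i
      ≡⟨ cong (λ e → m ∸ suc e) (sym (runEnd-descent bi)) ⟩
    m ∸ suc (runEnd i)
      ≤⟨ m≤m+n _ _ ⟩
    perm i ∎
    where open ≤-Reasoning

  value+start-< : ∀ {j} → j < m → perm j + runStart j < m
  value+start-< {j} j<m = begin-strict
    (m ∸ suc (runEnd j)) + (j ∸ runStart j) + runStart j
      ≡⟨ +-assoc (m ∸ suc (runEnd j)) _ _ ⟩
    (m ∸ suc (runEnd j)) + ((j ∸ runStart j) + runStart j)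
      ≡⟨ cong ((m ∸ suc (runEnd j)) +_) (m∸n+n≡m (runStart-≤ j)) ⟩
    (m ∸ suc (runEnd j)) + j
      <⟨ +-monoʳ-< (m ∸ suc (runEnd j)) (s≤s (m≤m+n j _)) ⟩
    (m ∸ suc (runEnd j)) + suc (runEnd j)
      ≡⟨ m∸n+n≡m (runEnd-<m j<m) ⟩
    m ∎
    where open ≤-Reasoning

  m-≤-value+end : ∀ {i} → i < m → m ≤ perm i + suc (runEnd i)
  m-≤-value+end {i} i<m = begin
    m                                      ≡⟨ sym (m∸n+n≡m (runEnd-<m i<m)) ⟩
    (m ∸ suc (runEnd i)) + suc (runEnd i)  ≤⟨ +-monoˡ-≤ (suc (runEnd i)) (m≤m+n _ _) ⟩
    perm i + suc (runEnd i)                ∎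
    where open ≤-Reasoning

  perm-bounded : BoundedOn perm m
  perm-bounded {j} j<m = ≤-<-trans (m≤m+n (perm j) (runStart j)) (value+start-< j<m)

  below-descent : ∀ {i j l} → i < m → j < m → i ≤ l → l < j → b l ≡ true → perm j < perm i
  below-descent {i} {j} {l} i<m j<m i≤l l<j bl = +-cancelʳ-< (suc l) (perm j) (perm i) (begin-strict
    perm j + suc l           ≤⟨ +-monoʳ-≤ (perm j) (start-after-descent bl l<j) ⟩
    perm j + runStart j      <⟨ value+start-< j<m ⟩
    m                        ≤⟨ m-≤-value+end i<m ⟩
    perm i + suc (runEnd i)  ≤⟨ +-monoʳ-≤ (perm i) (s≤s end≤l) ⟩
    perm i + suc l           ∎)
    where
    open ≤-Reasoning
    end≤l : runEnd i ≤ l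
    end≤l with k , refl ← m≤n⇒∃[o]m+o≡n i≤l = +-monoʳ-≤ i (end-before-descent k (m ∸ suc i) i bl)

  climb-or-descent : ∀ d i → i + d < m →
                     perm (i + d) ≡ perm i + d ⊎ ∃ λ l → i ≤ l × l < i + d × b l ≡ true
  climb-or-descent zero i _ = inj₁ (offset-zero perm i)
  climb-or-descent (suc d) i i+sd<m with b (i + d) in b[i+d]
  ... | true = inj₂ (i + d , m≤m+n i d , +-monoʳ-< i (n<1+n d) , b[i+d])
  ... | false with climb-or-descent d i (within {i} i+sd<m (n≤1+n d))
  ...   | inj₂ (l , i≤l , l<i+d , bl) = inj₂ (l , i≤l , <-trans l<i+d (+-monoʳ-< i (n<1+n d)) , bl)
  ...   | inj₁ climbs = inj₁ (begin
    perm (i + suc d)    ≡⟨ cong perm (+-suc i d) ⟩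
    perm (suc (i + d))  ≡⟨ perm-flat (subst (_< m) (+-suc i d) i+sd<m) b[i+d] ⟩
    suc (perm (i + d))  ≡⟨ cong suc climbs ⟩
    suc (perm i + d)    ≡⟨ sym (+-suc (perm i) d) ⟩
    perm i + suc d      ∎)
    where open ≡-Reasoning

  perm-distinct : ∀ {i j} → i < j → j < m → perm i ≢ perm j
  perm-distinct {i} i<j j<m e with d , refl ← m≤n⇒∃[o]m+o≡n (<⇒≤ i<j) with climb-or-descent d i j<m
  ... | inj₁ climbs = <⇒≢ (subst (perm i <_) (sym climbs) (m<m+n (perm i) 0<d)) e
    where
    0<d : 0 < d
    0<d = +-cancelˡ-< i 0 d (subst (_< i + d) (sym (+-identityʳ i)) i<j)
  ... | inj₂ (l , i≤l , l<j , bl) = <⇒≢ (below-descent (<-trans i<j j<m) j<m i≤l l<j bl) (sym e)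

  perm-injective : InjectiveOn perm m
  perm-injective {i} {j} i<m j<m e with <-cmp i j
  ... | tri< i<j _ _ = contradiction e (perm-distinct i<j j<m)
  ... | tri≈ _ i≡j _ = i≡j
  ... | tri> _ _ j<i = contradiction (sym e) (perm-distinct j<i i<m)

  perm-descents : ∀ l → suc l < m → descent perm l ≡ b l
  perm-descents l sl<m = by-cases (b l) refl
    where
    by-cases : ∀ c → b l ≡ c → descent perm l ≡ b l
    by-cases true bl = trans (<ᵇ-true (perm-descent sl<m bl)) (sym bl)
    by-cases false bl = trans (<ᵇ-false (subst (_≮ perm l) (sym (perm-flat sl<m bl)) (<-asym (n<1+n (perm l)))))
                              (sym bl)

  perm-unit : UnitAscents perm m
  perm-unit {i} si<m up = by-cases (b i) refl
    where
    by-cases : ∀ c → b i ≡ c → perm (suc i) ≡ suc (perm i)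
    by-cases true bi = contradiction (perm-descent si<m bi) (<-asym up)
    by-cases false bi = perm-flat si<m bi

mirror : ℕ → ℕ → ℕ
mirror m i = m ∸ suc i

mirror-< : ∀ {m i} → i < m → mirror m i < m
mirror-< {suc m} {i} _ = s≤s (m∸n≤m m i)

mirror-involutive : ∀ {m i} → i < m → mirror m (mirror m i) ≡ i
mirror-involutive {m} {i} i<m = begin
  m ∸ suc (mirror m i)                      ≡⟨ cong (_∸ suc (mirror m i)) (sym split) ⟩
  suc (mirror m i) + i ∸ suc (mirror m i)   ≡⟨ m+n∸m≡n (suc (mirror m i)) i ⟩
  i                                         ∎
  where
  open ≡-Reasoning
  split : suc (mirror m i) + i ≡ m
  split = trans (sym (+-suc (mirror m i) i)) (m∸n+n≡m i<m)

mirror-reverses : ∀ {m i j} → i < j → j < m → mirror m j < mirror m i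
mirror-reverses i<j j<m = ∸-monoʳ-< (s≤s i<j) j<m

mirror-cancel : ∀ {m i j} → mirror m j < mirror m i → i < j
mirror-cancel {m} {i} {j} lt = s≤s⁻¹ (∸-cancelʳ-< {suc j} {suc i} {m} lt)

mirror-suc : ∀ {m i} → suc i < m → suc (mirror m (suc i)) ≡ mirror m i
mirror-suc si<m = sym (∸-step si<m)

<ᵇ-cong : ∀ {x y u v} → (x < y → u < v) → (u < v → x < y) → (x <ᵇ y) ≡ (u <ᵇ v)
<ᵇ-cong {x} {y} {u} {v} to from with u <? v
... | yes u<v = trans (<ᵇ-true (from u<v)) (sym (<ᵇ-true u<v))
... | no u≮v = trans (<ᵇ-false (λ x<y → u≮v (to x<y))) (sym (<ᵇ-false u≮v))

mirror-<ᵇ : ∀ {m a b} → a < m → b < m → (mirror m a <ᵇ mirror m b) ≡ (b <ᵇ a)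
mirror-<ᵇ {m} a<m b<m = <ᵇ-cong (mirror-cancel {m}) (λ b<a → mirror-reverses b<a a<m)

reverseComplement : ℕ → (ℕ → ℕ) → ℕ → ℕ
reverseComplement m F i = mirror m (F (mirror m i))

module _ {F : ℕ → ℕ} {m : ℕ} (F<m : BoundedOn F m) where

  private
    R : ℕ → ℕ
    R = reverseComplement m F

  rc-bounded : BoundedOn R m
  rc-bounded i<m = mirror-< (F<m (mirror-< i<m))

  rc-injective : InjectiveOn F m → InjectiveOn R m
  rc-injective F-inj {i} {j} i<m j<m e = begin
    i                       ≡⟨ sym (mirror-involutive i<m) ⟩
    mirror m (mirror m i)   ≡⟨ cong (mirror m) (F-inj (mirror-< i<m) (mirror-< j<m) F-equal) ⟩
    mirror m (mirror m j)   ≡⟨ mirror-involutive j<m ⟩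
    j                       ∎
    where
    open ≡-Reasoning
    F-equal : F (mirror m i) ≡ F (mirror m j)
    F-equal = trans (sym (mirror-involutive (F<m (mirror-< i<m))))
                    (trans (cong (mirror m) e) (mirror-involutive (F<m (mirror-< j<m))))

  rc-descent : ∀ {l} → suc l < m → descent R l ≡ descent F (mirror m (suc l))
  rc-descent {l} sl<m = begin
    mirror m (F (mirror m (suc l))) <ᵇ mirror m (F (mirror m l))
      ≡⟨ mirror-<ᵇ (F<m (mirror-< sl<m)) (F<m (mirror-< (<-trans (n<1+n l) sl<m))) ⟩
    F (mirror m l) <ᵇ F (mirror m (suc l))
      ≡⟨ cong (λ p → F p <ᵇ F (mirror m (suc l))) (sym (mirror-suc sl<m)) ⟩
    F (suc (mirror m (suc l))) <ᵇ F (mirror m (suc l)) ∎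
    where open ≡-Reasoning

  rc-unit : UnitAscents F m → UnitAscents R m
  rc-unit F-unit {l} sl<m up = begin
    mirror m (F l′)                    ≡⟨ sym (mirror-suc (subst (_< m) step (F<m sl′<m))) ⟩
    suc (mirror m (suc (F l′)))        ≡⟨ cong (λ v → suc (mirror m v)) (sym step) ⟩
    suc (mirror m (F (suc l′)))        ≡⟨ cong (λ p → suc (mirror m (F p))) (mirror-suc sl<m) ⟩
    suc (R l)                          ∎
    where
    open ≡-Reasoning
    l′ : ℕ
    l′ = mirror m (suc l)
    sl′<m : suc l′ < m
    sl′<m = subst (_< m) (sym (mirror-suc sl<m)) (mirror-< (<-trans (n<1+n l) sl<m))
    step : F (suc l′) ≡ suc (F l′)
    step = F-unit sl′<m (mirror-cancel {m}
      (subst (λ p → mirror m (F p) < mirror m (F l′)) (sym (mirror-suc sl<m)) up))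

-- σ(i) + σ(m+1-i) = m+1, with positions and values counted from 0
CentrosymmetricOn : (ℕ → ℕ) → ℕ → Set
CentrosymmetricOn F m = ∀ {i} → i < m → suc (F i) + suc (F (mirror m i)) ≡ suc m

centro⇒fixed : ∀ {F m} → CentrosymmetricOn F m → ∀ {i} → i < m → reverseComplement m F i ≡ F i
centro⇒fixed {F} {m} cs {i} i<m =
  trans (cong (_∸ suc (F (mirror m i))) (sym (suc-injective (cs i<m)))) (m+n∸n≡m (F i) (suc (F (mirror m i))))

fixed⇒centro : ∀ {F m} → BoundedOn F m → (∀ {i} → i < m → F i ≡ reverseComplement m F i) →
               CentrosymmetricOn F m
fixed⇒centro {F} {m} F<m fixed {i} i<m =
  cong suc (trans (cong (_+ suc (F (mirror m i))) (fixed i<m)) (m∸n+n≡m (F<m (mirror-< i<m))))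

centro-reverses : ∀ {F m} → CentrosymmetricOn F m → ∀ {x y} → x < m → y < m →
                  F x < F y → F (mirror m y) < F (mirror m x)
centro-reverses {F} {m} cs {x} {y} x<m y<m Fx<Fy with F (mirror m y) <? F (mirror m x)
... | yes lt = lt
... | no ¬lt = contradiction (trans (cs x<m) (sym (cs y<m)))
                 (<⇒≢ (+-mono-<-≤ (s≤s Fx<Fy) (s≤s (≮⇒≥ ¬lt))))

-- Centrosymmetric 132-avoiding permutations.  Reverse-complement turns a 213 into a 132,
-- so these also avoid 213; hence no value lies strictly inside an ascent.
module Centrosymmetric132 {F : ℕ → ℕ} {m : ℕ} (F<m : BoundedOn F m) (F-inj : InjectiveOn F m)
                          (cs : CentrosymmetricOn F m) (av : Avoids132On F m) where

  no-value-inside-ascent : ∀ {i p} → suc i < m → p < m → F i < F p → F p < F (suc i) → ⊥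
  no-value-inside-ascent {i} {p} si<m p<m Fi<Fp Fp<Fsi with <-cmp p i
  ... | tri< p<i _ _ = av (mirror-reverses (n<1+n i) si<m) (mirror-reverses p<i i<m) (mirror-< p<m)
                          (centro-reverses cs p<m si<m Fp<Fsi) (centro-reverses cs i<m p<m Fi<Fp)
    where
    i<m : i < m
    i<m = <-trans (n<1+n i) si<m
  ... | tri≈ _ refl _ = <-irrefl refl Fi<Fp
  ... | tri> _ _ i<p with m≤n⇒m<n∨m≡n i<p
  ...   | inj₁ si<p = av (n<1+n i) si<p p<m Fi<Fp Fp<Fsi
  ...   | inj₂ refl = <-irrefl refl Fp<Fsi

  unit-ascents : UnitAscents F m
  unit-ascents {i} si<m up with m≤n⇒m<n∨m≡n up
  ... | inj₂ step = sym step
  ... | inj₁ gap with onto F<m F-inj (<-trans gap (F<m si<m))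
  ...   | p , p<m , Fp≡ = ⊥-elim (no-value-inside-ascent si<m p<m
                            (subst (F i <_) (sym Fp≡) (n<1+n (F i))) (subst (_< F (suc i)) (sym Fp≡) gap))

  palindromic-descents : ∀ l → suc l < m → descent F l ≡ descent F (mirror m (suc l))
  palindromic-descents l sl<m =
    trans (cong₂ _<ᵇ_ (sym (centro⇒fixed cs sl<m)) (sym (centro⇒fixed cs (<-trans (n<1+n l) sl<m))))
          (rc-descent F<m sl<m)

Palindromic : (ℕ → Bool) → ℕ → Set
Palindromic b m = ∀ l → suc l < m → b (mirror m (suc l)) ≡ b l

-- For a palindromic descent pattern, the permutation built from it is its own
-- reverse-complement, as both are unit-ascent permutations with the same descents.
perm-centrosymmetric : ∀ {b m} → Palindromic b m → CentrosymmetricOn (FromDescents.perm b m) m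
perm-centrosymmetric {b} {m} pal = fixed⇒centro perm-bounded
  (determined-by-descents perm-bounded (rc-bounded perm-bounded)
     perm-injective perm-unit (rc-injective perm-bounded perm-injective) (rc-unit perm-bounded perm-unit)
     same)
  where
  open FromDescents b m
  same : SameDescents perm (reverseComplement m perm) m
  same l sl<m = begin
    descent perm l                                   ≡⟨ perm-descents l sl<m ⟩
    b l                                              ≡⟨ sym (pal l sl<m) ⟩
    b (mirror m (suc l))                             ≡⟨ sym (perm-descents _ (subst (_< m) (sym (mirror-suc sl<m)) (mirror-< (<-trans (n<1+n l) sl<m)))) ⟩
    descent perm (mirror m (suc l))                  ≡⟨ sym (rc-descent perm-bounded sl<m) ⟩
    descent (reverseComplement m perm) l             ∎
    where open ≡-Reasoning

record Spells {k n : ℕ} (v : Vec (Fin k) n) (F : ℕ → ℕ) : Set where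
  constructor spelling
  field letter : ∀ j → toℕ (lookup v j) ≡ F (toℕ j)
open Spells

-- the letters of a word as a map on ℕ (0 beyond its end)
entries : ∀ {k n} → Vec (Fin k) n → ℕ → ℕ
entries [] i = 0
entries (x ∷ v) zero = toℕ x
entries (x ∷ v) (suc i) = entries v i

spells-entries : ∀ {k n} (v : Vec (Fin k) n) → Spells v (entries v)
spells-entries v = spelling (letters v)
  where
  letters : ∀ {k n} (v : Vec (Fin k) n) j → toℕ (lookup v j) ≡ entries v (toℕ j)
  letters (x ∷ v) Fin.zero = refl
  letters (x ∷ v) (Fin.suc j) = letters v j

wordOf : ∀ {m} (F : ℕ → ℕ) → BoundedOn F m → Word m
wordOf F F<m = tabulate λ j → fromℕ< (F<m (toℕ<n j))

spells-wordOf : ∀ {m} (F : ℕ → ℕ) (F<m : BoundedOn F m) → Spells (wordOf F F<m) F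
spells-wordOf F F<m = spelling λ j → trans (cong toℕ (lookup∘tabulate _ j)) (toℕ-fromℕ< (F<m (toℕ<n j)))

spells-at : ∀ {k n} {v : Vec (Fin k) n} {F} → Spells v F → ∀ {i} (i<n : i < n) → toℕ (lookup v (fromℕ< i<n)) ≡ F i
spells-at {F = F} sp i<n = trans (letter sp (fromℕ< i<n)) (cong F (toℕ-fromℕ< i<n))

spells-agree : ∀ {k n} {v : Vec (Fin k) n} {F G} → Spells v F → Spells v G → ∀ {i} → i < n → F i ≡ G i
spells-agree spF spG i<n = trans (sym (spells-at spF i<n)) (spells-at spG i<n)

lookup-ext : ∀ {A : Set} {n} {u v : Vec A n} → (∀ j → lookup u j ≡ lookup v j) → u ≡ v
lookup-ext {u = u} {v} u≗v = trans (sym (tabulate∘lookup u)) (trans (tabulate-cong u≗v) (tabulate∘lookup v))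

spells-ext : ∀ {k n} {u v : Vec (Fin k) n} {F G} → Spells u F → Spells v G →
             (∀ {i} → i < n → F i ≡ G i) → u ≡ v
spells-ext spF spG F≗G =
  lookup-ext λ j → toℕ-injective (trans (letter spF j) (trans (F≗G (toℕ<n j)) (sym (letter spG j))))

countTrue : (ℕ → Bool) → ℕ → ℕ
countTrue b zero = 0
countTrue b (suc n) = (if b 0 then 1 else 0) + countTrue (λ l → b (suc l)) n

countTrue-cong : ∀ {b b′} n → (∀ l → l < n → b l ≡ b′ l) → countTrue b n ≡ countTrue b′ n
countTrue-cong zero _ = refl
countTrue-cong (suc n) b≗b′ =
  cong₂ _+_ (cong (λ x → if x then 1 else 0) (b≗b′ 0 z<s)) (countTrue-cong n (λ l l<n → b≗b′ (suc l) (s≤s l<n)))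

des-spelled : ∀ {k n} {F} (v : Vec (Fin k) n) → Spells v F → desL (toList v) ≡ countTrue (descent F) (pred n)
des-spelled [] sp = refl
des-spelled (x ∷ []) sp = refl
des-spelled {F = F} (x ∷ y ∷ v) sp =
  cong₂ _+_ (cong₂ (λ a b → if a <ᵇ b then 1 else 0) (letter sp (Fin.suc Fin.zero)) (letter sp Fin.zero))
            (des-spelled {F = λ i → F (suc i)} (y ∷ v) (spelling λ j → letter sp (Fin.suc j)))

module _ {m : ℕ} {σ : Word m} {F : ℕ → ℕ} (sp : Spells σ F) where

  spelled-bounded : BoundedOn F m
  spelled-bounded i<m = subst (_< m) (spells-at sp i<m) (toℕ<n _)

  isPerm⇒injective : IsPerm σ → InjectiveOn F m
  isPerm⇒injective σ-perm {i} {j} i<m j<m e = begin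
    i                       ≡⟨ sym (toℕ-fromℕ< i<m) ⟩
    toℕ (fromℕ< i<m)        ≡⟨ cong toℕ (σ-perm _ _ (toℕ-injective same-letter)) ⟩
    toℕ (fromℕ< j<m)        ≡⟨ toℕ-fromℕ< j<m ⟩
    j                       ∎
    where
    open ≡-Reasoning
    same-letter : toℕ (lookup σ (fromℕ< i<m)) ≡ toℕ (lookup σ (fromℕ< j<m))
    same-letter = trans (spells-at sp i<m) (trans e (sym (spells-at sp j<m)))

  injective⇒isPerm : InjectiveOn F m → IsPerm σ
  injective⇒isPerm F-inj i j e =
    toℕ-injective (F-inj (toℕ<n i) (toℕ<n j) (trans (sym (letter sp i)) (trans (cong toℕ e) (letter sp j))))

  opposite-letter : ∀ j → toℕ (lookup σ (Fin.opposite j)) ≡ F (mirror m (toℕ j))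
  opposite-letter j = trans (letter sp (Fin.opposite j)) (cong F (opposite-prop j))

  centrosymmetric⇒centroOn : Centrosymmetric σ → CentrosymmetricOn F m
  centrosymmetric⇒centroOn cs {i} i<m =
    subst₂ (λ a c → suc a + suc c ≡ suc m) (spells-at sp i<m)
           (trans (opposite-letter (fromℕ< i<m)) (cong (λ p → F (mirror m p)) (toℕ-fromℕ< i<m)))
           (cs (fromℕ< i<m))

  centroOn⇒centrosymmetric : CentrosymmetricOn F m → Centrosymmetric σ
  centroOn⇒centrosymmetric cs j =
    subst₂ (λ a c → suc a + suc c ≡ suc m) (sym (letter sp j)) (sym (opposite-letter j)) (cs (toℕ<n j))

  avoids⇒avoidsOn : Avoids132 σ → Avoids132On F m
  avoids⇒avoidsOn av {i} {j} {k} i<j j<k k<m Fi<Fk Fk<Fj =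
    av (fromℕ< i<m , fromℕ< j<m , fromℕ< k<m , position i<m j<m i<j , position j<m k<m j<k ,
        value i<m k<m Fi<Fk , value k<m j<m Fk<Fj)
    where
    j<m : j < m
    j<m = <-trans j<k k<m
    i<m : i < m
    i<m = <-trans i<j j<m
    position : ∀ {a b} (a<m : a < m) (b<m : b < m) → a < b → toℕ (fromℕ< a<m) < toℕ (fromℕ< b<m)
    position a<m b<m = subst₂ _<_ (sym (toℕ-fromℕ< a<m)) (sym (toℕ-fromℕ< b<m))
    value : ∀ {a b} (a<m : a < m) (b<m : b < m) → F a < F b →
            toℕ (lookup σ (fromℕ< a<m)) < toℕ (lookup σ (fromℕ< b<m))
    value a<m b<m = subst₂ _<_ (sym (spells-at sp a<m)) (sym (spells-at sp b<m))

  avoidsOn⇒avoids : Avoids132On F m → Avoids132 σ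
  avoidsOn⇒avoids av (i , j , k , i<j , j<k , σi<σk , σk<σj) =
    av i<j j<k (toℕ<n k) (subst₂ _<_ (letter sp i) (letter sp k) σi<σk)
                         (subst₂ _<_ (letter sp k) (letter sp j) σk<σj)

-- the l-th bit of a list, false beyond its end
bitAt : List Bool → ℕ → Bool
bitAt [] _ = false
bitAt (x ∷ xs) zero = x
bitAt (x ∷ xs) (suc l) = bitAt xs l

bitAt-++ˡ : ∀ xs ys {l} → l < length xs → bitAt (xs ++ ys) l ≡ bitAt xs l
bitAt-++ˡ (x ∷ xs) ys {zero} _ = refl
bitAt-++ˡ (x ∷ xs) ys {suc l} l<len = bitAt-++ˡ xs ys (s≤s⁻¹ l<len)

bitAt-++ʳ : ∀ xs ys l → bitAt (xs ++ ys) (length xs + l) ≡ bitAt ys l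
bitAt-++ʳ [] ys l = refl
bitAt-++ʳ (x ∷ xs) ys l = bitAt-++ʳ xs ys l

bitAt-reverse : ∀ xs {l} → l < length xs → bitAt (reverse xs) l ≡ bitAt xs (mirror (length xs) l)
bitAt-reverse (x ∷ xs) {l} l<len rewrite unfold-reverse x xs with m≤n⇒m<n∨m≡n (s≤s⁻¹ l<len)
... | inj₁ l<len′ = begin
  bitAt (reverse xs ++ x ∷ []) l           ≡⟨ bitAt-++ˡ (reverse xs) _ (subst (l <_) (sym (length-reverse xs)) l<len′) ⟩
  bitAt (reverse xs) l                     ≡⟨ bitAt-reverse xs l<len′ ⟩
  bitAt xs (mirror (length xs) l)          ≡⟨ cong (bitAt (x ∷ xs)) (sym (∸-step l<len′)) ⟩
  bitAt (x ∷ xs) (length xs ∸ l)           ∎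
  where open ≡-Reasoning
... | inj₂ refl = begin
  bitAt (reverse xs ++ x ∷ []) (length xs)             ≡⟨ cong (bitAt (reverse xs ++ x ∷ [])) (sym len) ⟩
  bitAt (reverse xs ++ x ∷ []) (length (reverse xs) + 0) ≡⟨ bitAt-++ʳ (reverse xs) (x ∷ []) 0 ⟩
  x                                                    ≡⟨ cong (bitAt (x ∷ xs)) (sym (n∸n≡0 (length xs))) ⟩
  bitAt (x ∷ xs) (length xs ∸ length xs)               ∎
  where
  open ≡-Reasoning
  len : length (reverse xs) + 0 ≡ length xs
  len = trans (+-identityʳ _) (length-reverse xs)

bitAt-toList : ∀ {n} (u : Vec Bool n) j → bitAt (toList u) (toℕ j) ≡ lookup u j
bitAt-toList (x ∷ u) Fin.zero = refl
bitAt-toList (x ∷ u) (Fin.suc j) = bitAt-toList u j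

palindrome : ∀ {n} → Vec Bool n → Bool → List Bool
palindrome u c = toList u ++ c ∷ reverse (toList u)

length-toList : ∀ {A : Set} {n} (v : Vec A n) → length (toList v) ≡ n
length-toList [] = refl
length-toList (x ∷ v) = cong suc (length-toList v)

length-palindrome : ∀ {n} (u : Vec Bool n) c → length (palindrome u c) ≡ n + suc n
length-palindrome {n} u c = begin
  length (toList u ++ c ∷ reverse (toList u))          ≡⟨ length-++ (toList u) ⟩
  length (toList u) + suc (length (reverse (toList u))) ≡⟨ cong₂ (λ a b → a + suc b) (length-toList u)
                                                             (trans (length-reverse (toList u)) (length-toList u)) ⟩
  n + suc n ∎
  where open ≡-Reasoning

reverse-palindrome : ∀ {n} (u : Vec Bool n) c → reverse (palindrome u c) ≡ palindrome u c
reverse-palindrome u c = begin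
  reverse (xs ++ c ∷ reverse xs)                   ≡⟨ reverse-++ xs (c ∷ reverse xs) ⟩
  reverse (c ∷ reverse xs) ++ reverse xs           ≡⟨ cong (_++ reverse xs) (unfold-reverse c (reverse xs)) ⟩
  (reverse (reverse xs) ++ c ∷ []) ++ reverse xs   ≡⟨ ++-assoc (reverse (reverse xs)) (c ∷ []) (reverse xs) ⟩
  reverse (reverse xs) ++ c ∷ reverse xs           ≡⟨ cong (_++ c ∷ reverse xs) (reverse-involutive xs) ⟩
  xs ++ c ∷ reverse xs                             ∎
  where
  open ≡-Reasoning
  xs : List Bool
  xs = toList u

bitAt-palindrome-mirror : ∀ {n} (u : Vec Bool n) c {l} → l < n + suc n →
                          bitAt (palindrome u c) (mirror (n + suc n) l) ≡ bitAt (palindrome u c) l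
bitAt-palindrome-mirror {n} u c {l} l<len = begin
  bitAt (palindrome u c) (mirror (n + suc n) l)                ≡⟨ cong (λ z → bitAt (palindrome u c) (mirror z l)) (sym len) ⟩
  bitAt (palindrome u c) (mirror (length (palindrome u c)) l) ≡⟨ sym (bitAt-reverse (palindrome u c) (subst (l <_) (sym len) l<len)) ⟩
  bitAt (reverse (palindrome u c)) l                          ≡⟨ cong (λ p → bitAt p l) (reverse-palindrome u c) ⟩
  bitAt (palindrome u c) l                                    ∎
  where
  open ≡-Reasoning
  len = length-palindrome u c

bitAt-palindrome-left : ∀ {n} (u : Vec Bool n) c j → bitAt (palindrome u c) (toℕ j) ≡ lookup u j
bitAt-palindrome-left u c j =
  trans (bitAt-++ˡ (toList u) _ (subst (toℕ j <_) (sym (length-toList u)) (toℕ<n j))) (bitAt-toList u j)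

bitAt-palindrome-centre : ∀ {n} (u : Vec Bool n) c → bitAt (palindrome u c) n ≡ c
bitAt-palindrome-centre u c =
  trans (cong (bitAt (palindrome u c)) (sym (trans (+-identityʳ _) (length-toList u)))) (bitAt-++ʳ (toList u) _ 0)

trues : List Bool → ℕ
trues [] = 0
trues (x ∷ xs) = (if x then 1 else 0) + trues xs

countTrue-bitAt : ∀ xs → countTrue (bitAt xs) (length xs) ≡ trues xs
countTrue-bitAt [] = refl
countTrue-bitAt (x ∷ xs) = cong ((if x then 1 else 0) +_) (countTrue-bitAt xs)

trues-++ : ∀ xs ys → trues (xs ++ ys) ≡ trues xs + trues ys
trues-++ [] ys = refl
trues-++ (x ∷ xs) ys = trans (cong ((if x then 1 else 0) +_) (trues-++ xs ys)) (sym (+-assoc (if x then 1 else 0) _ _))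

trues-reverse : ∀ xs → trues (reverse xs) ≡ trues xs
trues-reverse [] = refl
trues-reverse (x ∷ xs) = begin
  trues (reverse (x ∷ xs))                   ≡⟨ cong trues (unfold-reverse x xs) ⟩
  trues (reverse xs ++ x ∷ [])               ≡⟨ trues-++ (reverse xs) (x ∷ []) ⟩
  trues (reverse xs) + ((if x then 1 else 0) + 0)
                                             ≡⟨ cong₂ _+_ (trues-reverse xs) (+-identityʳ _) ⟩
  trues xs + (if x then 1 else 0)            ≡⟨ +-comm (trues xs) _ ⟩
  trues (x ∷ xs)                             ∎
  where open ≡-Reasoning

-- the number of descents of the permutation coded by (u , c)
weight : ∀ {n} → Vec Bool n × Bool → ℕ
weight (u , c) = (if c then 1 else 0) + (trues (toList u) + trues (toList u))

trues-palindrome : ∀ {n} (u : Vec Bool n) c → trues (palindrome u c) ≡ weight (u , c)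
trues-palindrome u c = begin
  trues (xs ++ c ∷ reverse xs)                      ≡⟨ trues-++ xs (c ∷ reverse xs) ⟩
  trues xs + ((if c then 1 else 0) + trues (reverse xs))
                                                    ≡⟨ cong (λ t → trues xs + ((if c then 1 else 0) + t)) (trues-reverse xs) ⟩
  trues xs + ((if c then 1 else 0) + trues xs)      ≡⟨ sym (+-assoc (trues xs) _ _) ⟩
  trues xs + (if c then 1 else 0) + trues xs        ≡⟨ cong (_+ trues xs) (+-comm (trues xs) _) ⟩
  (if c then 1 else 0) + trues xs + trues xs        ≡⟨ +-assoc (if c then 1 else 0) _ _ ⟩
  weight (u , c)                                    ∎
  where
  open ≡-Reasoning
  xs : List Bool
  xs = toList u

tally : ∀ {A : Set} → (A → ℕ) → List A → ℕ
tally g [] = 0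
tally g (x ∷ xs) = g x + tally g xs

tally-cong : ∀ {A : Set} {g h : A → ℕ} xs → (∀ x → g x ≡ h x) → tally g xs ≡ tally h xs
tally-cong [] g≗h = refl
tally-cong (x ∷ xs) g≗h = cong₂ _+_ (g≗h x) (tally-cong xs g≗h)

tally-++ : ∀ {A : Set} (g : A → ℕ) xs ys → tally g (xs ++ ys) ≡ tally g xs + tally g ys
tally-++ g [] ys = refl
tally-++ g (x ∷ xs) ys = trans (cong (g x +_) (tally-++ g xs ys)) (sym (+-assoc (g x) _ _))

tally-map : ∀ {A B : Set} (g : B → ℕ) (f : A → B) xs → tally g (map f xs) ≡ tally (λ x → g (f x)) xs
tally-map g f [] = refl
tally-map g f (x ∷ xs) = cong (g (f x) +_) (tally-map g f xs)

tally-cartesian : ∀ {A B C : Set} (g : C → ℕ) (f : A → B → C) xs ys →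
                  tally g (cartesianProductWith f xs ys) ≡ tally (λ x → tally (λ y → g (f x y)) ys) xs
tally-cartesian g f [] ys = refl
tally-cartesian g f (x ∷ xs) ys =
  trans (tally-++ g (map (f x) ys) _) (cong₂ _+_ (tally-map g (f x) ys) (tally-cartesian g f xs ys))

tally-zero : ∀ {A : Set} (xs : List A) → tally (λ _ → 0) xs ≡ 0
tally-zero [] = refl
tally-zero (x ∷ xs) = tally-zero xs

length-filter : ∀ {A : Set} {P : A → Set} (P? : Decidable P) xs →
                length (filter P? xs) ≡ tally (λ x → if does (P? x) then 1 else 0) xs
length-filter P? [] = refl
length-filter P? (x ∷ xs) with does (P? x)
... | true = cong suc (length-filter P? xs)
... | false = length-filter P? xs

eqInd : ℕ → ℕ → ℕ
eqInd x y = if x ≡ᵇ y then 1 else 0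

bools : List Bool
bools = true ∷ false ∷ []

allVec : ∀ n → List (Vec Bool n)
allVec zero = [] ∷ []
allVec (suc n) = cartesianProductWith _∷_ bools (allVec n)

codes : ∀ n → List (Vec Bool n × Bool)
codes n = cartesianProduct (allVec n) bools

binomial-count : ∀ n j → tally (λ u → eqInd (trues (toList u)) j) (allVec n) ≡ n C j
binomial-count zero zero = refl
binomial-count zero (suc j) = refl
binomial-count (suc n) j =
  trans (tally-cartesian (λ u → eqInd (trues (toList u)) j) _∷_ bools (allVec n)) (by-last-bit j)
  where
  by-last-bit : ∀ j → tally (λ u → eqInd (suc (trues (toList u))) j) (allVec n)
                      + (tally (λ u → eqInd (trues (toList u)) j) (allVec n) + 0) ≡ suc n C j
  by-last-bit zero = cong₂ _+_ (tally-zero (allVec n)) (trans (+-identityʳ _) (binomial-count n zero))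
  by-last-bit (suc j) = trans (cong₂ _+_ (binomial-count n j) (trans (+-identityʳ _) (binomial-count n (suc j))))
                               (nCk+nC[k+1]≡[n+1]C[k+1] n j)

half-suc-suc : ∀ k → suc (suc k) / 2 ≡ suc (k / 2)
half-suc-suc k = m/n≡1+[m∸n]/n {suc (suc k)} {2} (s≤s (s≤s z≤n))

halving : ∀ o k → eqInd (suc (o + o)) k + eqInd (o + o) k ≡ eqInd o (k / 2)
halving zero zero = refl
halving (suc o) zero = refl
halving zero (suc zero) = refl
halving (suc o) (suc zero) rewrite +-suc o o = refl
halving zero (suc (suc k)) rewrite half-suc-suc k = refl
halving (suc o) (suc (suc k)) rewrite +-suc o o | half-suc-suc k = halving o k

codes-of-weight : ∀ n k → length (filter (λ p → weight p ≟ k) (codes n)) ≡ n C (k / 2)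
codes-of-weight n k = begin
  length (filter (λ p → weight p ≟ k) (codes n))
    ≡⟨ length-filter (λ p → weight p ≟ k) (codes n) ⟩
  tally (λ p → eqInd (weight p) k) (codes n)
    ≡⟨ tally-cartesian (λ p → eqInd (weight p) k) _,_ (allVec n) bools ⟩
  tally (λ u → eqInd (suc (ones u + ones u)) k + (eqInd (ones u + ones u) k + 0)) (allVec n)
    ≡⟨ tally-cong (allVec n) (λ u → trans (cong (eqInd (suc (ones u + ones u)) k +_) (+-identityʳ _)) (halving (ones u) k)) ⟩
  tally (λ u → eqInd (ones u) (k / 2)) (allVec n)
    ≡⟨ binomial-count n (k / 2) ⟩
  n C (k / 2) ∎
  where
  open ≡-Reasoning
  ones : Vec Bool n → ℕ
  ones u = trues (toList u)

same-length : ∀ {A : Set} {xs ys : List A} → Unique xs → Unique ys →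
              (∀ {z} → z ∈ xs → z ∈ ys) → (∀ {z} → z ∈ ys → z ∈ xs) → length xs ≡ length ys
same-length xs! ys! to from = ↭-length (∼bag⇒↭ (unique∧set⇒bag xs! ys! (mk⇔ to from)))

words-as-product : ∀ m n → words m (suc n) ≡ cartesianProductWith _∷_ (allFin m) (words m n)
words-as-product m n = by-induction (allFin m)
  where
  by-induction : ∀ xs → concatMap (λ x → map (x ∷_) (words m n)) xs ≡ cartesianProductWith _∷_ xs (words m n)
  by-induction [] = refl
  by-induction (x ∷ xs) = cong (map (x ∷_) (words m n) ++_) (by-induction xs)

words-unique : ∀ m n → Unique (words m n)
words-unique m zero = [] ∷ []
words-unique m (suc n) = subst Unique (sym (words-as-product m n))
  (Unique.cartesianProductWith⁺ _∷_ ∷-injective (Unique.allFin⁺ m) (words-unique m n))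

words-complete : ∀ m {n} (v : Vec (Fin m) n) → v ∈ words m n
words-complete m [] = here refl
words-complete m (x ∷ v) = subst (x ∷ v ∈_) (sym (words-as-product m _))
  (∈-cartesianProductWith⁺ _∷_ (∈-allFin x) (words-complete m v))

bools-unique : Unique bools
bools-unique = ((λ ()) ∷ []) ∷ [] ∷ []

bools-complete : ∀ c → c ∈ bools
bools-complete true = here refl
bools-complete false = there (here refl)

allVec-unique : ∀ n → Unique (allVec n)
allVec-unique zero = [] ∷ []
allVec-unique (suc n) = Unique.cartesianProductWith⁺ _∷_ ∷-injective bools-unique (allVec-unique n)

allVec-complete : ∀ {n} (v : Vec Bool n) → v ∈ allVec n
allVec-complete [] = here refl
allVec-complete (x ∷ v) = ∈-cartesianProductWith⁺ _∷_ (bools-complete x) (allVec-complete v)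

codes-unique : ∀ n → Unique (codes n)
codes-unique n = Unique.cartesianProduct⁺ (allVec-unique n) bools-unique

codes-complete : ∀ {n} (p : Vec Bool n × Bool) → p ∈ codes n
codes-complete (u , c) = ∈-cartesianProduct⁺ (allVec-complete u) (bools-complete c)

module Classification (n : ℕ) where

  L : ℕ
  L = n + suc n

  m : ℕ
  m = suc L

  descentPattern : Vec Bool n × Bool → ℕ → Bool
  descentPattern (u , c) = bitAt (palindrome u c)

  descentPattern-palindromic : ∀ p → Palindromic (descentPattern p) m
  descentPattern-palindromic (u , c) l sl<m = bitAt-palindrome-mirror u c (s≤s⁻¹ sl<m)

  des-by-pattern : ∀ {σ : Word m} {F} p → Spells σ F → (∀ l → l < L → descent F l ≡ descentPattern p l) →
                   des σ ≡ weight p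
  des-by-pattern {σ} {F} (u , c) sp follows = begin
    des σ                                                    ≡⟨ des-spelled σ sp ⟩
    countTrue (descent F) L                                  ≡⟨ countTrue-cong L follows ⟩
    countTrue (bitAt (palindrome u c)) L                     ≡⟨ cong (countTrue (bitAt (palindrome u c))) (sym (length-palindrome u c)) ⟩
    countTrue (bitAt (palindrome u c)) (length (palindrome u c)) ≡⟨ countTrue-bitAt (palindrome u c) ⟩
    trues (palindrome u c)                                   ≡⟨ trues-palindrome u c ⟩
    weight (u , c)                                           ∎
    where open ≡-Reasoning

  module Coded (p : Vec Bool n × Bool) where
    open FromDescents (descentPattern p) m public

    codeWord : Word m
    codeWord = wordOf perm perm-bounded

    spells : Spells codeWord perm
    spells = spells-wordOf perm perm-bounded

    isPerm : IsPerm codeWord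
    isPerm = injective⇒isPerm spells perm-injective

    centrosymmetric : Centrosymmetric codeWord
    centrosymmetric = centroOn⇒centrosymmetric spells (perm-centrosymmetric (descentPattern-palindromic p))

    avoids : Avoids132 codeWord
    avoids = avoidsOn⇒avoids spells (UnitAscentMap.avoids-132 perm-injective perm-unit)

    des-codeWord : des codeWord ≡ weight p
    des-codeWord = des-by-pattern p spells (λ l l<L → perm-descents l (s≤s l<L))

  open Coded using (codeWord)

  codeWord-injective : ∀ {p p′} → codeWord p ≡ codeWord p′ → p ≡ p′
  codeWord-injective {u , c} {u′ , c′} same = cong₂ _,_
    (lookup-ext λ j → begin
      lookup u j                      ≡⟨ sym (bitAt-palindrome-left u c j) ⟩
      descentPattern (u , c) (toℕ j)         ≡⟨ same-pattern (s≤s (≤-trans (toℕ<n j) (m≤m+n n (suc n)))) ⟩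
      descentPattern (u′ , c′) (toℕ j)       ≡⟨ bitAt-palindrome-left u′ c′ j ⟩
      lookup u′ j                     ∎)
    (trans (sym (bitAt-palindrome-centre u c))
           (trans (same-pattern (s≤s (m<m+n n z<s))) (bitAt-palindrome-centre u′ c′)))
    where
    open ≡-Reasoning
    module P = Coded (u , c)
    module P′ = Coded (u′ , c′)
    same-perm : ∀ {i} → i < m → P.perm i ≡ P′.perm i
    same-perm = spells-agree P.spells (subst (λ w → Spells w P′.perm) (sym same) P′.spells)
    same-pattern : ∀ {l} → suc l < m → descentPattern (u , c) l ≡ descentPattern (u′ , c′) l
    same-pattern {l} sl<m = begin
      descentPattern (u , c) l      ≡⟨ sym (P.perm-descents l sl<m) ⟩
      descent P.perm l       ≡⟨ cong₂ _<ᵇ_ (same-perm sl<m) (same-perm (<-trans (n<1+n l) sl<m)) ⟩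
      descent P′.perm l      ≡⟨ P′.perm-descents l sl<m ⟩
      descentPattern (u′ , c′) l    ∎

  mirror-right-half : ∀ {l} → n < l → l < L → mirror L l < n
  mirror-right-half {l} n<l l<L = +-cancelʳ-< (suc l) (mirror L l) n
    (subst (_< n + suc l) (sym (m∸n+n≡m l<L)) (+-monoʳ-< n (s≤s n<l)))

  -- every permutation in C_m(132) is coded, namely by its first n+1 descents
  module Decoded {σ : Word m} (σ-perm : IsPerm σ) (σ-cs : Centrosymmetric σ) (σ-av : Avoids132 σ) where

    F : ℕ → ℕ
    F = entries σ

    sp : Spells σ F
    sp = spells-entries σ

    F<m : BoundedOn F m
    F<m = spelled-bounded sp

    F-inj : InjectiveOn F m
    F-inj = isPerm⇒injective sp σ-perm

    open Centrosymmetric132 F<m F-inj (centrosymmetric⇒centroOn sp σ-cs) (avoids⇒avoidsOn sp σ-av)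

    codeOf : Vec Bool n × Bool
    codeOf = tabulate (λ j → descent F (toℕ j)) , descent F n

    follows-left : ∀ {l} → l < n → descentPattern codeOf l ≡ descent F l
    follows-left {l} l<n = begin
      descentPattern codeOf l                              ≡⟨ cong (descentPattern codeOf) (sym (toℕ-fromℕ< l<n)) ⟩
      descentPattern codeOf (toℕ (fromℕ< l<n))             ≡⟨ bitAt-palindrome-left (proj₁ codeOf) (proj₂ codeOf) (fromℕ< l<n) ⟩
      lookup (proj₁ codeOf) (fromℕ< l<n)                   ≡⟨ lookup∘tabulate _ (fromℕ< l<n) ⟩
      descent F (toℕ (fromℕ< l<n))                         ≡⟨ cong (descent F) (toℕ-fromℕ< l<n) ⟩
      descent F l                                          ∎
      where open ≡-Reasoning

    -- the right half of both patterns mirrors the left half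
    follows : ∀ l → suc l < m → descentPattern codeOf l ≡ descent F l
    follows l sl<m with <-cmp l n
    ... | tri< l<n _ _ = follows-left l<n
    ... | tri≈ _ refl _ = bitAt-palindrome-centre (proj₁ codeOf) (proj₂ codeOf)
    ... | tri> _ _ n<l = begin
      descentPattern codeOf l                   ≡⟨ sym (descentPattern-palindromic codeOf l sl<m) ⟩
      descentPattern codeOf (mirror L l)        ≡⟨ follows-left (mirror-right-half n<l (s≤s⁻¹ sl<m)) ⟩
      descent F (mirror L l)                    ≡⟨ sym (palindromic-descents l sl<m) ⟩
      descent F l                               ∎
      where open ≡-Reasoning

    open Coded codeOf using (perm; perm-bounded; perm-injective; perm-unit; perm-descents; spells)

    decoded : σ ≡ codeWord codeOf
    decoded = spells-ext sp spells
      (determined-by-descents F<m perm-bounded F-inj unit-ascents perm-injective perm-unit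
         λ l sl<m → trans (sym (follows l sl<m)) (sym (perm-descents l sl<m)))

    des-decoded : des σ ≡ weight codeOf
    des-decoded = des-by-pattern codeOf sp (λ l l<L → sym (follows l (s≤s l<L)))

  inC? : (σ : Word m) → Dec (IsPerm σ × Centrosymmetric σ × Avoids132 σ)
  inC? σ = isPerm? σ ×-dec centro? σ ×-dec avoids132? σ

  codeWord-properties : ∀ p → IsPerm (codeWord p) × Centrosymmetric (codeWord p) × Avoids132 (codeWord p)
  codeWord-properties p = Coded.isPerm p , Coded.centrosymmetric p , Coded.avoids p

  codeWord-in-C : ∀ p → codeWord p ∈ C132 m
  codeWord-in-C p = ∈-filter⁺ inC? {xs = words m m} (words-complete m (codeWord p)) (codeWord-properties p)

  decode : ∀ {σ} → σ ∈ C132 m → ∃ λ p → σ ≡ codeWord p × des σ ≡ weight p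
  decode {σ} σ∈C with _ , (σ-perm , σ-cs , σ-av) ← ∈-filter⁻ inC? {xs = words m m} σ∈C =
    codeOf , decoded , des-decoded
    where open Decoded {σ} σ-perm σ-cs σ-av using (codeOf; decoded; des-decoded)

  module Count (k : ℕ) where

    hasK? : (σ : Word m) → Dec (des σ ≡ k)
    hasK? σ = des σ ≟ k

    ofWeight? : (p : Vec Bool n × Bool) → Dec (weight p ≡ k)
    ofWeight? p = weight p ≟ k

    withK : List (Word m)
    withK = filter hasK? (C132 m)

    coded : List (Word m)
    coded = map codeWord (filter ofWeight? (codes n))

    withK-unique : Unique withK
    withK-unique = Unique.filter⁺ hasK? (Unique.filter⁺ inC? (words-unique m m))

    coded-unique : Unique coded
    coded-unique = Unique.map⁺ codeWord-injective (Unique.filter⁺ ofWeight? (codes-unique n))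

    coded-member : ∀ p → weight p ≡ k → codeWord p ∈ coded
    coded-member p weight≡k = ∈-map⁺ codeWord (∈-filter⁺ ofWeight? (codes-complete p) weight≡k)

    withK-member : ∀ p → p ∈ filter ofWeight? (codes n) → codeWord p ∈ withK
    withK-member p p∈ = ∈-filter⁺ hasK? (codeWord-in-C p)
      (trans (Coded.des-codeWord p) (proj₂ (∈-filter⁻ ofWeight? {xs = codes n} p∈)))

    withK⊆coded : ∀ {σ} → σ ∈ withK → σ ∈ coded
    withK⊆coded {σ} σ∈ = by-decoding (decode σ∈C) desσ≡k
      where
      σ∈C : σ ∈ C132 m
      σ∈C = proj₁ (∈-filter⁻ hasK? {xs = C132 m} σ∈)
      desσ≡k : des σ ≡ k
      desσ≡k = proj₂ (∈-filter⁻ hasK? {xs = C132 m} σ∈)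
      by-decoding : ∀ {σ} → (∃ λ p → σ ≡ codeWord p × des σ ≡ weight p) → des σ ≡ k → σ ∈ coded
      by-decoding (p , σ≡p , desσ≡weight) desσ≡k =
        subst (_∈ coded) (sym σ≡p) (coded-member p (trans (sym desσ≡weight) desσ≡k))

    coded⊆withK : ∀ {σ} → σ ∈ coded → σ ∈ withK
    coded⊆withK σ∈ = by-preimage (∈-map⁻ codeWord σ∈)
      where
      by-preimage : ∀ {σ} → (∃ λ p → p ∈ filter ofWeight? (codes n) × σ ≡ codeWord p) → σ ∈ withK
      by-preimage (p , p∈ , σ≡p) = subst (_∈ withK) (sym σ≡p) (withK-member p p∈)

    count : length withK ≡ n C (k / 2)
    count = begin
      length withK                        ≡⟨ same-length withK-unique coded-unique withK⊆coded coded⊆withK ⟩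
      length coded                        ≡⟨ length-map codeWord (filter ofWeight? (codes n)) ⟩
      length (filter ofWeight? (codes n)) ≡⟨ codes-of-weight n k ⟩
      n C (k / 2)                         ∎
      where open ≡-Reasoning

theorem1 : (q 0 0 ≡ 1)
         × (∀ (k : ℕ) → q 0 (suc k) ≡ 0)
         × (∀ (n k : ℕ) → q (suc n) k ≡ n C (k / 2))
theorem1 = refl , (λ k → refl) , λ n k →
  subst (λ m → length (filter (λ σ → des σ ≟ k) (C132 m)) ≡ n C (k / 2))
        (sym (cong (λ z → suc (n + z)) (+-identityʳ (suc n))))
        (Classification.Count.count n k)
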